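{- Let $G$ be a connected word-representable graph on $n=|V(G)|$ vertices with representation number $k>1$, and let $w$ be a $k$-uniform word representing $G$. Let $v$ be the shortest (possibly empty) suffix of $w$ such that, writing $w=w_1v$, the last $n$ letters of $w_1$ do not form a permutation of $V(G)$. Then $|v|\le n$.
   Context: A word $w$ over the alphabet $V$ represents the simple graph $G=(V,E)$ if every letter of $V$ occurs in $w$ and, for all distinct $x,y\in V$, $x$ and $y$ alternate in $w$ (deleting all other letters leaves $xyxy\cdots$ or $yxyx\cdots$) if and only if $xy\in E$. A word is $k$-uniform if every letter occurs exactly $k$ times; the representation number of $G$ is the least $k$ such that some $k$-uniform word represents $G$. A permutation of $V$ is a word in which every letter of $V$ occurs exactly once. -}

module Defs where

open import Data.Nat using (ℕ; _<_; _∸_; _≤_)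
open import Data.Fin using (Fin; _≟_)
open import Data.List using (List; []; _∷_; filter; length; drop; _++_)
open import Data.List.Membership.Propositional using (_∈_)
open import Data.Product using (Σ; _×_; ∃)
open import Data.Empty using (⊥)
open import Relation.Nullary using (¬_)
open import Relation.Nullary.Decidable using (_⊎-dec_)
open import Relation.Binary.PropositionalEquality using (_≡_; _≢_)
open import Relation.Binary.Construct.Closure.ReflexiveTransitive using (Star)
open import Function.Bundles using (_⇔_)

record SimpleGraph (n : ℕ) : Set₁ where
  field
    Adj    : Fin n → Fin n → Set
    sym    : ∀ {x y} → Adj x y → Adj y x
    irrefl : ∀ {x} → ¬ Adj x x
open SimpleGraph public

Connected : ∀ {n} → SimpleGraph n → Set
Connected {n} G = (x y : Fin n) → Star (Adj G) x y

Word : ℕ → Set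
Word n = List (Fin n)

count : ∀ {n} → Fin n → Word n → ℕ
count x w = length (filter (_≟ x) w)

restrict : ∀ {n} → Fin n → Fin n → Word n → Word n
restrict x y w = filter (λ z → (z ≟ x) ⊎-dec (z ≟ y)) w

data NoAdjRepeat {n : ℕ} : Word n → Set where
  nil  : NoAdjRepeat []
  one  : ∀ x → NoAdjRepeat (x ∷ [])
  cons : ∀ {x y ws} → x ≢ y → NoAdjRepeat (y ∷ ws) → NoAdjRepeat (x ∷ y ∷ ws)

-- x and y alternate in w: deleting all other letters leaves xyxy… or yxyx…
Alternate : ∀ {n} → Fin n → Fin n → Word n → Set
Alternate x y w = NoAdjRepeat (restrict x y w)

Represents : ∀ {n} → Word n → SimpleGraph n → Set
Represents {n} w G =
  ((x : Fin n) → x ∈ w) ×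
  ((x y : Fin n) → x ≢ y → (Alternate x y w ⇔ Adj G x y))

Uniform : ∀ {n} → ℕ → Word n → Set
Uniform {n} k w = (x : Fin n) → count x w ≡ k

RepresentationNumber : ∀ {n} → SimpleGraph n → ℕ → Set
RepresentationNumber {n} G k =
  (Σ (Word n) λ w → Uniform k w × Represents w G) ×
  ((m : ℕ) → m < k → (w : Word n) → Uniform m w → ¬ Represents w G)

IsPermutation : ∀ {n} → Word n → Set
IsPermutation {n} u = (x : Fin n) → count x u ≡ 1

-- the last n letters of a word (the whole word if it is shorter)
lastN : ∀ {n} → ℕ → Word n → Word n
lastN m u = drop (length u ∸ m) u

BadSplit : ∀ {n} → Word n → Word n → Set
BadSplit {n} w₁ v = ¬ IsPermutation (lastN n w₁)

ShortestBadSuffix : ∀ {n} → Word n → Word n → Word n → Set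
ShortestBadSuffix {n} w w₁ v =
  (w ≡ w₁ ++ v) × BadSplit w₁ v ×
  ((w₁' v' : Word n) → w ≡ w₁' ++ v' → length v' < length v → ¬ BadSplit w₁' v')

-- If the suffix v were longer than n, every length-n window ending at most n letters before
-- the end of w would be a permutation.  Two consecutive such windows share n − 1 letters, so
-- the letter leaving one window equals the letter entering the next: the last 2n letters of w
-- have period n, i.e. w = u d d with d a permutation.  Deleting one copy of d lowers every
-- letter count by one and keeps every alternation (between distinct letters x and y, the
-- factor d contributes exactly xy or yx), so u d is a (k − 1)-uniform representant of G,
-- contradicting the minimality of k.
module Submission where

open import Defs hiding (sym)
open import Data.Nat using (ℕ; zero; suc; _+_; _∸_; _<_; _≤_; _≤?_)
  renaming (_≟_ to _≟ℕ_)
open import Data.Nat.Properties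
  using (suc-injective; +-suc; m+n∸n≡m; m≤n⇒m∸n≡0; m≤n+m; ≤-trans; ≤-reflexive;
         ≤-<-trans; <⇒≤; ≰⇒>; n<1+n; m∸[m∸n]≡n)
open import Data.Fin using (Fin; _≟_)
open import Data.Fin.Properties using (all?)
open import Data.List using ([]; _∷_; [_]; _∷ʳ_; filter; length; take; drop; _++_)
open import Data.List.Properties
  using (filter-++; length-++; length-++-comm; length-++-sucʳ; length-++-≤ʳ; length-drop;
         take++drop≡id; ++-assoc; ++-identityʳ)
open import Data.List.Reverse using (Reverse; reverseView; []; _∶_∶ʳ_)
open import Data.List.Membership.Propositional using (_∈_)
open import Data.List.Membership.Propositional.Properties using (∈-++⁺ʳ)
open import Data.List.Relation.Unary.Any using (here; there)
open import Data.Product using (_,_; _×_; ∃; ∃₂)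
open import Data.Sum using (_⊎_; inj₁; inj₂)
open import Data.Empty using (⊥; ⊥-elim)
open import Relation.Nullary using (¬_; Dec; yes; no)
open import Relation.Nullary.Decidable using (decidable-stable; _⊎-dec_)
open import Relation.Binary.PropositionalEquality
  using (_≡_; _≢_; refl; sym; trans; cong; cong₂; subst; module ≡-Reasoning)
open import Function.Bundles using (_⇔_; mk⇔)
open import Function.Properties.Equivalence using () renaming (sym to ⇔-sym; trans to ⇔-trans)
open import Function.Base using (_∘_)

module _ {n : ℕ} where

  count-++ : (x : Fin n) (u t : Word n) → count x (u ++ t) ≡ count x u + count x t
  count-++ x u t = trans (cong length (filter-++ (_≟ x) u t)) (length-++ (filter (_≟ x) u))

  count-∷ : (x : Fin n) (u : Word n) → count x (x ∷ u) ≡ suc (count x u)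
  count-∷ x u with x ≟ x
  ... | yes _  = refl
  ... | no x≢x = ⊥-elim (x≢x refl)

  count-[_]≡1⇒≡ : (y : Fin n) {x : Fin n} → count x [ y ] ≡ 1 → y ≡ x
  count-[ y ]≡1⇒≡ {x} c with y ≟ x
  ... | yes y≡x = y≡x
  ... | no _    with () ← c

  count≡suc⇒∈ : (x : Fin n) (u : Word n) {m : ℕ} → count x u ≡ suc m → x ∈ u
  count≡suc⇒∈ x (y ∷ u) c with y ≟ x
  ... | yes y≡x = here (sym y≡x)
  ... | no _    = there (count≡suc⇒∈ x u c)

  isPermutation? : (u : Word n) → Dec (IsPermutation u)
  isPermutation? u = all? (λ x → count x u ≟ℕ 1)

  ∷-permutation-∷ʳ⇒≡ : (y d : Fin n) (i : Word n) →
                       IsPermutation (y ∷ i) → IsPermutation (i ∷ʳ d) → y ≡ d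
  ∷-permutation-∷ʳ⇒≡ y d i p q = sym (count-[ d ]≡1⇒≡ count-[d]≡1)
    where
    y∉i : count y i ≡ 0
    y∉i = suc-injective (trans (sym (count-∷ y i)) (p y))
    count-[d]≡1 : count y [ d ] ≡ 1
    count-[d]≡1 = begin
      count y [ d ]               ≡⟨ cong (_+ count y [ d ]) (sym y∉i) ⟩
      count y i + count y [ d ]   ≡⟨ sym (count-++ y i [ d ]) ⟩
      count y (i ∷ʳ d)            ≡⟨ q y ⟩
      1                           ∎
      where open ≡-Reasoning

  permutation⇒∷ʳ-¬permutation : (d : Fin n) (i : Word n) → IsPermutation i → ¬ IsPermutation (i ∷ʳ d)
  permutation⇒∷ʳ-¬permutation d i p q
    with () ← trans (sym (q d)) (trans (count-++ d i [ d ]) (cong₂ _+_ (p d) (count-∷ d [])))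

  lastN-++ : (m : ℕ) (u t : Word n) → length t ≡ m → lastN m (u ++ t) ≡ t
  lastN-++ _ u t refl rewrite length-++ u {t} | m+n∸n≡m (length u) (length t) = drop-length u
    where
    drop-length : (u : Word n) → drop (length u) (u ++ t) ≡ t
    drop-length []      = refl
    drop-length (_ ∷ u) = drop-length u

  lastN-short : (m : ℕ) (u : Word n) → length u ≤ m → lastN m u ≡ u
  lastN-short m u u≤m rewrite m≤n⇒m∸n≡0 u≤m = refl

  permutation-windows⇒period : (u i : Word n) (d : Fin n) → suc (length i) ≡ n →
                               IsPermutation (i ∷ʳ d) → IsPermutation (lastN n (u ++ i)) →
                               ∃ λ u′ → u ≡ u′ ∷ʳ d
  permutation-windows⇒period u i d len p q with reverseView u
  ... | [] = ⊥-elim (permutation⇒∷ʳ-¬permutation d i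
                       (subst IsPermutation (lastN-short n i (<⇒≤ (≤-reflexive len))) q) p)
  ... | u′ ∶ _ ∶ʳ y = u′ , cong (u′ ∷ʳ_) (∷-permutation-∷ʳ⇒≡ y d i (subst IsPermutation window q) p)
    where
    window : lastN n ((u′ ∷ʳ y) ++ i) ≡ y ∷ i
    window = trans (cong (lastN n) (++-assoc u′ [ y ] i)) (lastN-++ n u′ (y ∷ i) len)

  ++-assoc₃ : (a b c e : Word n) → (a ++ b ++ c) ++ e ≡ a ++ b ++ c ++ e
  ++-assoc₃ a b c e = trans (++-assoc a (b ++ c) e) (cong (a ++_) (++-assoc b c e))

  PermutationWindows : Word n → Set
  PermutationWindows w =
    (u t : Word n) → w ≡ u ++ t → length t ≤ n → IsPermutation (lastN n u)

  split-at-length : (m : ℕ) (w : Word n) → m ≤ length w → ∃₂ λ u c → w ≡ u ++ c × length c ≡ m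
  split-at-length m w m≤w =
    take (length w ∸ m) w , drop (length w ∸ m) w , sym (take++drop≡id (length w ∸ m) w) ,
    trans (length-drop (length w ∸ m) w) (m∸[m∸n]≡n m≤w)

  -- A step turns u d (c ∷ʳ x) d into u′ (x ∷ d) c (x ∷ d): the permutation windows d c x and
  -- y d c ending before the suffixes d and x ∷ d force the letter y = last u to be x.
  PermutationSquareSuffix : Word n → Set
  PermutationSquareSuffix w = ∃₂ λ u d → w ≡ u ++ d ++ d × IsPermutation d

  permutationWindows⇒square-suffix : (w : Word n) → n ≤ length w → PermutationWindows w →
                                     PermutationSquareSuffix w
  permutationWindows⇒square-suffix w n≤w windows
    with u , c , w≡uc , c≡n ← split-at-length n w n≤w =
    shift (reverseView c) u [] (trans (cong length (++-identityʳ c)) c≡n)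
          (trans w≡uc (cong (u ++_) (sym (++-identityʳ c))))
    where
    shift : ∀ {c} → Reverse c → (u d : Word n) → length (c ++ d) ≡ n → w ≡ u ++ d ++ c ++ d →
            PermutationSquareSuffix w
    shift [] u d d≡n w≡udd =
      u , d , w≡udd ,
      subst IsPermutation (lastN-++ n u d d≡n)
        (windows (u ++ d) d (trans w≡udd (sym (++-assoc u d d))) (≤-reflexive d≡n))
    shift (c ∶ rc ∶ʳ x) u d cxd≡n w≡udcxd =
      continue (permutation-windows⇒period u (d ++ c) x dc≡n-1 window-d window-xd)
      where
      cxd≡c++xd : (c ∷ʳ x) ++ d ≡ c ++ x ∷ d
      cxd≡c++xd = ++-assoc c [ x ] d
      cxd≡n′ : length (c ++ x ∷ d) ≡ n
      cxd≡n′ = trans (cong length (sym cxd≡c++xd)) cxd≡n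
      dc≡n-1 : suc (length (d ++ c)) ≡ n
      dc≡n-1 = trans (cong suc (length-++-comm d c)) (trans (sym (length-++-sucʳ c x d)) cxd≡n′)
      window-d : IsPermutation ((d ++ c) ∷ʳ x)
      window-d = subst IsPermutation (trans (lastN-++ n u (d ++ c ∷ʳ x) dcx≡n) (sym (++-assoc d c [ x ])))
        (windows (u ++ d ++ c ∷ʳ x) d (trans w≡udcxd (sym (++-assoc₃ u d (c ∷ʳ x) d)))
                 (≤-trans (length-++-≤ʳ d {c ∷ʳ x}) (≤-reflexive cxd≡n)))
        where
        dcx≡n : length (d ++ c ∷ʳ x) ≡ n
        dcx≡n = trans (length-++-comm d (c ∷ʳ x)) cxd≡n
      window-xd : IsPermutation (lastN n (u ++ d ++ c))
      window-xd = windows (u ++ d ++ c) (x ∷ d)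
        (trans w≡udcxd (trans (cong (λ t → u ++ d ++ t) cxd≡c++xd) (sym (++-assoc₃ u d c (x ∷ d)))))
        (≤-trans (length-++-≤ʳ (x ∷ d) {c}) (≤-reflexive cxd≡n′))
      continue : (∃ λ u′ → u ≡ u′ ∷ʳ x) → PermutationSquareSuffix w
      continue (u′ , refl) = shift rc u′ (x ∷ d) cxd≡n′
        (trans w≡udcxd (trans (++-assoc u′ [ x ] _) (cong (λ t → u′ ++ x ∷ d ++ t) cxd≡c++xd)))

  restrict-++ : (x y : Fin n) (u t : Word n) → restrict x y (u ++ t) ≡ restrict x y u ++ restrict x y t
  restrict-++ x y = filter-++ (λ z → (z ≟ x) ⊎-dec (z ≟ y))

  restrict≡[] : (x y : Fin n) (u : Word n) → count x u ≡ 0 → count y u ≡ 0 → restrict x y u ≡ []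
  restrict≡[] x y []      _  _  = refl
  restrict≡[] x y (z ∷ u) cx cy with z ≟ x | z ≟ y
  ... | yes _ | _     with () ← cx
  ... | no _  | yes _ with () ← cy
  ... | no _  | no _  = restrict≡[] x y u cx cy

  restrict≡[y] : (x y : Fin n) (u : Word n) → count x u ≡ 0 → count y u ≡ 1 → restrict x y u ≡ [ y ]
  restrict≡[y] x y (z ∷ u) cx cy with z ≟ x | z ≟ y
  ... | yes _ | _        with () ← cx
  ... | no _  | yes refl = cong (z ∷_) (restrict≡[] x z u cx (suc-injective cy))
  ... | no _  | no _     = restrict≡[y] x y u cx cy

  restrict≡[x] : (x y : Fin n) (u : Word n) → count x u ≡ 1 → count y u ≡ 0 → restrict x y u ≡ [ x ]
  restrict≡[x] x y (z ∷ u) cx cy with z ≟ x | z ≟ y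
  ... | _        | yes _ with () ← cy
  ... | yes refl | no _  = cong (z ∷_) (restrict≡[] z y u (suc-injective cx) cy)
  ... | no _     | no _  = restrict≡[x] x y u cx cy

  restrict≡xy⊎yx : (x y : Fin n) (u : Word n) → x ≢ y → count x u ≡ 1 → count y u ≡ 1 →
                   restrict x y u ≡ x ∷ y ∷ [] ⊎ restrict x y u ≡ y ∷ x ∷ []
  restrict≡xy⊎yx x y (z ∷ u) x≢y cx cy with z ≟ x | z ≟ y
  ... | yes refl | yes refl = ⊥-elim (x≢y refl)
  ... | yes refl | no _     = inj₁ (cong (z ∷_) (restrict≡[y] z y u (suc-injective cx) cy))
  ... | no _     | yes refl = inj₂ (cong (z ∷_) (restrict≡[x] x z u cx (suc-injective cy)))
  ... | no _     | no _     = restrict≡xy⊎yx x y u x≢y cx cy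

  NoAdjRepeat-++⁻ˡ : (r t : Word n) → NoAdjRepeat (r ++ t) → NoAdjRepeat r
  NoAdjRepeat-++⁻ˡ []          _ _          = nil
  NoAdjRepeat-++⁻ˡ (a ∷ [])    _ _          = one a
  NoAdjRepeat-++⁻ˡ (a ∷ b ∷ r) t (cons p h) = cons p (NoAdjRepeat-++⁻ˡ (b ∷ r) t h)

  NoAdjRepeat-++-++ : (r s t : Word n) {b : Fin n} →
                      NoAdjRepeat (r ++ b ∷ s) → NoAdjRepeat (b ∷ s ++ t) → NoAdjRepeat (r ++ b ∷ s ++ t)
  NoAdjRepeat-++-++ []          s t _          h = h
  NoAdjRepeat-++-++ (a ∷ [])    s t (cons p _) h = cons p h
  NoAdjRepeat-++-++ (a ∷ a′ ∷ r) s t (cons p h′) h = cons p (NoAdjRepeat-++-++ (a′ ∷ r) s t h′ h)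

  Alternate-++-square : (x y : Fin n) (u d : Word n) → x ≢ y → IsPermutation d →
                        Alternate x y (u ++ d ++ d) ⇔ Alternate x y (u ++ d)
  Alternate-++-square x y u d x≢y d-perm = mk⇔
    (λ h → subst NoAdjRepeat (sym restrict-ud)
             (NoAdjRepeat-++⁻ˡ (r ++ s) s (subst NoAdjRepeat (trans restrict-udd (sym (++-assoc r s s))) h)))
    (λ h → subst NoAdjRepeat (sym restrict-udd)
             (repeat s (restrict≡xy⊎yx x y d x≢y (d-perm x) (d-perm y)) (subst NoAdjRepeat restrict-ud h)))
    where
    r = restrict x y u
    s = restrict x y d
    restrict-ud : restrict x y (u ++ d) ≡ r ++ s
    restrict-ud = restrict-++ x y u d
    restrict-udd : restrict x y (u ++ d ++ d) ≡ r ++ s ++ s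
    restrict-udd = trans (restrict-++ x y u (d ++ d)) (cong (r ++_) (restrict-++ x y d d))
    repeat : (s : Word n) → s ≡ x ∷ y ∷ [] ⊎ s ≡ y ∷ x ∷ [] → NoAdjRepeat (r ++ s) → NoAdjRepeat (r ++ s ++ s)
    repeat _ (inj₁ refl) h = NoAdjRepeat-++-++ r [ y ] _ h (cons x≢y (cons (x≢y ∘ sym) (cons x≢y (one y))))
    repeat _ (inj₂ refl) h = NoAdjRepeat-++-++ r [ x ] _ h (cons (x≢y ∘ sym) (cons x≢y (cons (x≢y ∘ sym) (one x))))

  Uniform-++-square : {k : ℕ} (u d : Word n) → IsPermutation d → Uniform (suc k) (u ++ d ++ d) → Uniform k (u ++ d)
  Uniform-++-square {k} u d d-perm uniform x = suc-injective (begin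
    suc (count x (u ++ d))               ≡⟨ cong suc (count-++ x u d) ⟩
    suc (count x u + count x d)          ≡⟨ cong (λ m → suc (count x u + m)) (d-perm x) ⟩
    suc (count x u + 1)                  ≡⟨ sym (+-suc (count x u) 1) ⟩
    count x u + (1 + 1)                  ≡⟨ cong (λ m → count x u + (m + m)) (sym (d-perm x)) ⟩
    count x u + (count x d + count x d)  ≡⟨ cong (count x u +_) (sym (count-++ x d d)) ⟩
    count x u + count x (d ++ d)         ≡⟨ sym (count-++ x u (d ++ d)) ⟩
    count x (u ++ d ++ d)                ≡⟨ uniform x ⟩
    suc k                                ∎)
    where open ≡-Reasoning

  Represents-++-square : (G : SimpleGraph n) (u d : Word n) → IsPermutation d →
                         Represents (u ++ d ++ d) G → Represents (u ++ d) G
  Represents-++-square G u d d-perm (_ , alternation) =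
    (λ x → ∈-++⁺ʳ u (count≡suc⇒∈ x d (d-perm x))) ,
    (λ x y x≢y → ⇔-trans (⇔-sym (Alternate-++-square x y u d x≢y d-perm)) (alternation x y x≢y))

mainTheorem13 : (n : ℕ) (G : SimpleGraph n) → Connected G →
                (k : ℕ) → RepresentationNumber G k → 1 < k →
                (w : Word n) → Uniform k w → Represents w G →
                (w₁ v : Word n) → ShortestBadSuffix w w₁ v →
                length v ≤ n
mainTheorem13 n G _ zero    _ ()
mainTheorem13 n G _ (suc k) (_ , minimal) _ w uniform represents w₁ v (w≡w₁v , _ , shorter-good)
  with length v ≤? n
... | yes v≤n = v≤n
... | no v≰n = ⊥-elim (shorter-representant (permutationWindows⇒square-suffix w n≤w windows))
  where
  n<v : n < length v
  n<v = ≰⇒> v≰n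
  n≤w : n ≤ length w
  n≤w = ≤-trans (<⇒≤ n<v) (≤-trans (m≤n+m (length v) (length w₁))
                                   (≤-reflexive (sym (trans (cong length w≡w₁v) (length-++ w₁)))))
  windows : PermutationWindows w
  windows u t w≡ut t≤n = decidable-stable (isPermutation? (lastN n u)) (shorter-good u t w≡ut (≤-<-trans t≤n n<v))
  shorter-representant : PermutationSquareSuffix w → ⊥
  shorter-representant (u , d , w≡udd , d-perm) = minimal k (n<1+n k) (u ++ d)
    (Uniform-++-square u d d-perm (subst (Uniform (suc k)) w≡udd uniform))
    (Represents-++-square G u d d-perm (subst (λ t → Represents t G) w≡udd represents))
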